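{- A quadruple $X=\langle X,\tau,\le,X_0\rangle$ is a Hansoul space if and only if it is a generalized Priestley space.
   Context: A Priestley space is a compact space with a partial order $\le$ such that if $x\not\le y$ there is a clopen upset containing $x$ and not $y$. For $X=\langle X,\tau,\le,X_0\rangle$ with $\langle X,\tau,\le\rangle$ a Priestley space and $X_0\subseteq X$, a clopen upset $U$ is admissible if $\mathrm{max}(X-U)\subseteq X_0$; $X^*$ is the set of admissible clopen upsets and $\mathcal{I}_x=\{U\in X^*:x\notin U\}$. $X$ is a generalized Priestley space if: (1) $\langle X,\tau,\le\rangle$ is a Priestley space; (2) $X_0$ is dense in $X$; (3) for each $x\in X$ there is $y\in X_0$ with $x\le y$; (4) $x\in X_0$ iff $\mathcal{I}_x$ is directed (for all $U,V\in\mathcal{I}_x$ there is $W\in\mathcal{I}_x$ with $U\cup V\subseteq W$); (5) for all $x,y\in X$, $x\le y$ iff every $U\in X^*$ with $x\in U$ satisfies $y\in U$. $X$ is a Hansoul space if: (1) $\langle X,\tau,\le\rangle$ is a Priestley space; (2) $X_0$ is dense in $X$; (3) if $x\not\le y$ then there is $z\in X_0$ with $x\not\le z$ and $y\le z$; (4) $X_0$ is exactly the set of those $x\in X$ for which the clopen downsets $D$ with $x\in D$ and with $D\cap X_0$ cofinal in $D$ (i.e. $\mathrm{max}(D)\subseteq X_0$) form a basis of clopen downset neighbourhoods of $x$ (every clopen downset containing $x$ contains such a $D$ containing $x$); (5) for each $x\in X$ there is $y\in X_0$ with $x\le y$. -}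

module Defs where

open import Level using (Level; 0ℓ) renaming (suc to lsuc)
open import Data.Nat using (ℕ)
open import Data.Fin using (Fin)
open import Data.Product using (Σ; ∃; _×_; _,_)
open import Data.Unit using (⊤)
open import Data.Sum using (_⊎_)
open import Relation.Nullary using (¬_)
open import Relation.Unary using (Pred; _∈_; _∉_; _⊆_; _∩_; ∁)
open import Relation.Binary using (Rel; IsPartialOrder)
open import Relation.Binary.PropositionalEquality using (_≡_)
open import Function.Bundles using (_⇔_)

Subset : Set → Set₁
Subset X = Pred X 0ℓ

record Topology (X : Set) : Set₁ where
  field
    Open      : Subset X → Set
    open-resp : ∀ {U V : Subset X} → U ⊆ V → V ⊆ U → Open U → Open V
    open-univ : Open (λ _ → ⊤)
    open-∩    : ∀ {U V : Subset X} → Open U → Open V → Open (U ∩ V)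
    open-⋃    : (I : Set) (F : I → Subset X) → (∀ i → Open (F i)) →
                Open (λ x → ∃ λ i → x ∈ F i)

module _ {X : Set} (τ : Topology X) where
  open Topology τ

  Closed : Subset X → Set
  Closed U = Open (∁ U)

  Clopen : Subset X → Set
  Clopen U = Open U × Closed U

  Compact : Set₁
  Compact = (I : Set) (F : I → Subset X) → (∀ i → Open (F i)) →
            (∀ x → ∃ λ i → x ∈ F i) →
            ∃ λ (n : ℕ) → Σ (Fin n → I) λ f → ∀ x → ∃ λ k → x ∈ F (f k)

  Dense : Subset X → Set₁
  Dense D = ∀ (U : Subset X) → Open U → (∃ λ x → x ∈ U) → ∃ λ x → x ∈ U × x ∈ D

module _ {X : Set} (_≤_ : Rel X 0ℓ) where

  UpSet : Subset X → Set
  UpSet U = ∀ {x y} → x ∈ U → x ≤ y → y ∈ U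

  DownSet : Subset X → Set
  DownSet D = ∀ {x y} → x ∈ D → y ≤ x → y ∈ D

  Max : Subset X → Subset X
  Max A x = x ∈ A × (∀ y → y ∈ A → x ≤ y → x ≡ y)

record IsPriestley {X : Set} (τ : Topology X) (_≤_ : Rel X 0ℓ) : Set₁ where
  field
    isPartialOrder : IsPartialOrder _≡_ _≤_
    compact        : Compact τ
    separation     : ∀ x y → ¬ (x ≤ y) →
                     ∃ λ (U : Subset X) → Clopen τ U × UpSet _≤_ U × x ∈ U × y ∉ U

module _ {X : Set} (τ : Topology X) (_≤_ : Rel X 0ℓ) (X₀ : Subset X) where

  -- admissible clopen upsets: members of X*
  Admissible : Subset X → Set
  Admissible U = Clopen τ U × UpSet _≤_ U × (Max _≤_ (∁ U) ⊆ X₀)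

  InI : X → Subset X → Set
  InI x U = Admissible U × x ∉ U

  IDirected : X → Set₁
  IDirected x = ∀ U V → InI x U → InI x V →
                ∃ λ (W : Subset X) → InI x W × U ⊆ W × V ⊆ W

  record IsGeneralizedPriestley : Set₁ where
    field
      priestley : IsPriestley τ _≤_
      dense     : Dense τ X₀
      cofinal   : ∀ x → ∃ λ y → y ∈ X₀ × x ≤ y
      X₀-char   : ∀ x → (x ∈ X₀) ⇔ IDirected x
      ≤-char    : ∀ x y → (x ≤ y) ⇔ (∀ U → Admissible U → x ∈ U → y ∈ U)

  GoodDown : Subset X → Set
  GoodDown D = Clopen τ D × DownSet _≤_ D × (Max _≤_ D ⊆ X₀)

  GoodBasis : X → Set₁
  GoodBasis x = ∀ (D : Subset X) → Clopen τ D → DownSet _≤_ D → x ∈ D →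
                ∃ λ (D' : Subset X) → GoodDown D' × x ∈ D' × D' ⊆ D

  record IsHansoul : Set₁ where
    field
      priestley : IsPriestley τ _≤_
      dense     : Dense τ X₀
      separate  : ∀ x y → ¬ (x ≤ y) → ∃ λ z → z ∈ X₀ × ¬ (x ≤ z) × y ≤ z
      X₀-char   : ∀ x → (x ∈ X₀) ⇔ GoodBasis x
      cofinal   : ∀ x → ∃ λ y → y ∈ X₀ × x ≤ y

Zorn : (a : Level) → Set (lsuc a)
Zorn a = (A : Set a) (R : Rel A a) → IsPartialOrder _≡_ R →
         (∀ (C : Pred A a) → (∀ {x y} → x ∈ C → y ∈ C → R x y ⊎ R y x) →
            ∃ λ u → ∀ {c} → c ∈ C → R c u) →
         ∃ λ m → ∀ b → R m b → m ≡ b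

-- Complementation exchanges admissible clopen upsets and clopen downsets D with
-- max D ⊆ X₀. Hence a good clopen downset inside ∁U ∩ ∁V bounds U, V ∈ 𝓘ₓ; and,
-- when X* separates points, a clopen downset neighbourhood D of x is covered by
-- D together with members of 𝓘ₓ, so by compactness and directedness some
-- W ∈ 𝓘ₓ has ∁W ⊆ D. Separation by X* is equivalent to condition (5) of
-- generalized Priestley spaces, and it yields condition (3) of Hansoul spaces
-- through a maximal point of the closed set ↑y ∖ U, which exists by Zorn's lemma
-- because chains in closed sets of a compact Priestley space are bounded.
module Submission where

open import Defs
open import Level using (Level; 0ℓ)
open import Relation.Binary using (Rel; IsPartialOrder)
open import Axiom.ExcludedMiddle using (ExcludedMiddle)
open import Axiom.DoubleNegationElimination using (em⇒dne)
open import Function using (_∘_)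
open import Function.Bundles using (_⇔_; mk⇔; Equivalence)
open import Function.Construct.Composition using (_⇔-∘_)
open import Function.Construct.Symmetry using (⇔-sym)
open import Data.Bool using (Bool; true; false)
open import Data.Nat using (zero; suc)
open import Data.Fin using (Fin; zero; suc)
open import Data.Vec.Functional using (_∷_)
open import Data.Product using (Σ; ∃; _×_; _,_; proj₁; proj₂)
open import Data.Sum using (_⊎_; inj₁; inj₂)
open import Data.Unit using (tt)
open import Data.Empty using (⊥; ⊥-elim)
open import Relation.Nullary using (¬_; yes; no)
open import Relation.Unary using (_∈_; _∉_; _⊆_; _∩_; _∪_; ∁; ∅)
open import Relation.Binary.PropositionalEquality
  using (_≡_; refl; sym; subst; isEquivalence)

IsChain : {X : Set} → Rel X 0ℓ → Subset X → Set
IsChain _≤_ C = ∀ {a b} → a ∈ C → b ∈ C → a ≤ b ⊎ b ≤ a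

module OrderFacts (em : ExcludedMiddle 0ℓ) {X : Set} {_≤_ : Rel X 0ℓ}
                  (po : IsPartialOrder _≡_ _≤_) where
  private module PO = IsPartialOrder po

  chain-finite-bound : ∀ {C} → IsChain _≤_ C → ∀ n (a : Fin (suc n) → X) →
                       (∀ i → a i ∈ C) → ∃ λ q → q ∈ C × (∀ i → a i ≤ q)
  chain-finite-bound ch zero a a∈C = a zero , a∈C zero , λ { zero → PO.refl }
  chain-finite-bound ch (suc n) a a∈C
    with chain-finite-bound ch n (a ∘ suc) (a∈C ∘ suc)
  ... | q , q∈C , a≤q with ch (a∈C zero) q∈C
  ...   | inj₁ a₀≤q = q , q∈C , λ { zero → a₀≤q ; (suc i) → a≤q i }
  ...   | inj₂ q≤a₀ = a zero , a∈C zero ,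
                      λ { zero → PO.refl ; (suc i) → PO.trans (a≤q i) q≤a₀ }

  -- Zorn is applied to the order on all of X which puts every point outside A
  -- below every point of A, so that an upper bound in A of the A-part of a chain
  -- bounds the whole chain.
  maximal-in : Zorn 0ℓ → (A : Subset X) →
               (∀ C → C ⊆ A → IsChain _≤_ C →
                  ∃ λ u → u ∈ A × (∀ {c} → c ∈ C → c ≤ u)) →
               ∃ (Max _≤_ A)
  maximal-in zorn A chains-bounded =
    m , m∈A , λ w w∈A m≤w → m-max w (inj₂ (w∈A , λ _ → m≤w))
    where
    _⊑_ : Rel X 0ℓ
    a ⊑ b = a ≡ b ⊎ (b ∈ A × (a ∈ A → a ≤ b))

    ⊑-trans : ∀ {a b c} → a ⊑ b → b ⊑ c → a ⊑ c
    ⊑-trans (inj₁ refl) b⊑c = b⊑c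
    ⊑-trans a⊑b (inj₁ refl) = a⊑b
    ⊑-trans (inj₂ (b∈A , a≤b)) (inj₂ (c∈A , b≤c)) =
      inj₂ (c∈A , λ a∈A → PO.trans (a≤b a∈A) (b≤c b∈A))

    ⊑-antisym : ∀ {a b} → a ⊑ b → b ⊑ a → a ≡ b
    ⊑-antisym (inj₁ a≡b) _ = a≡b
    ⊑-antisym _ (inj₁ b≡a) = sym b≡a
    ⊑-antisym (inj₂ (b∈A , a≤b)) (inj₂ (a∈A , b≤a)) =
      PO.antisym (a≤b a∈A) (b≤a b∈A)

    ⊑-isPartialOrder : IsPartialOrder _≡_ _⊑_
    ⊑-isPartialOrder = record
      { isPreorder = record
        { isEquivalence = isEquivalence ; reflexive = inj₁ ; trans = ⊑-trans }
      ; antisym    = ⊑-antisym }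

    ⊑⇒≤ : ∀ {a b} → a ⊑ b → a ∈ A → a ≤ b
    ⊑⇒≤ (inj₁ refl) _ = PO.refl
    ⊑⇒≤ (inj₂ (_ , a≤b)) a∈A = a≤b a∈A

    ⊑-chains-bounded : ∀ C → IsChain _⊑_ C → ∃ λ u → ∀ {c} → c ∈ C → c ⊑ u
    ⊑-chains-bounded C ch with chains-bounded (C ∩ A) proj₂ ≤-chain
      where
      ≤-chain : IsChain _≤_ (C ∩ A)
      ≤-chain (a∈C , a∈A) (b∈C , b∈A) with ch a∈C b∈C
      ... | inj₁ a⊑b = inj₁ (⊑⇒≤ a⊑b a∈A)
      ... | inj₂ b⊑a = inj₂ (⊑⇒≤ b⊑a b∈A)
    ... | u , u∈A , ub = u , λ c∈C → inj₂ (u∈A , λ c∈A → ub (c∈C , c∈A))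

    maximal : ∃ λ m → ∀ b → m ⊑ b → m ≡ b
    maximal = zorn X _⊑_ ⊑-isPartialOrder ⊑-chains-bounded

    m : X
    m = proj₁ maximal

    m-max : ∀ b → m ⊑ b → m ≡ b
    m-max = proj₂ maximal

    m∈A : m ∈ A
    m∈A with chains-bounded (λ _ → ⊥) (λ ()) (λ ())
    ... | u , u∈A , _ = em⇒dne em λ m∉A →
      m∉A (subst (_∈ A) (sym (m-max u (inj₂ (u∈A , ⊥-elim ∘ m∉A)))) u∈A)

module TopologyFacts (em : ExcludedMiddle 0ℓ) {X : Set} (τ : Topology X) where
  open Topology τ

  ∁-clopen : ∀ {U} → Clopen τ U → Clopen τ (∁ U)
  ∁-clopen (U-open , U-closed) =
    U-closed , open-resp (λ u ∁u → ∁u u) (em⇒dne em) U-open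

  ∅-clopen : Clopen τ ∅
  ∅-clopen = open-resp (λ { (() , _) }) (λ ()) (open-⋃ ⊥ (λ _ _ → ⊥) (λ ())) ,
             open-resp (λ _ ()) (λ _ → tt) open-univ

  ∪-open : ∀ {U V} → Open U → Open V → Open (U ∪ V)
  ∪-open {U} {V} U-open V-open =
    open-resp (λ { (true , u) → inj₁ u ; (false , v) → inj₂ v })
              (λ { (inj₁ u) → true , u ; (inj₂ v) → false , v })
              (open-⋃ Bool F λ { true → U-open ; false → V-open })
    where
    F : Bool → Subset X
    F true  = U
    F false = V

  ∩-closed : ∀ {A B} → Closed τ A → Closed τ B → Closed τ (A ∩ B)
  ∩-closed {A} {B} A-closed B-closed =
    open-resp [∁A∪∁B]⊆∁[A∩B] ∁[A∩B]⊆∁A∪∁B (∪-open A-closed B-closed)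
    where
    [∁A∪∁B]⊆∁[A∩B] : ∁ A ∪ ∁ B ⊆ ∁ (A ∩ B)
    [∁A∪∁B]⊆∁[A∩B] (inj₁ ∉A) (a , _) = ∉A a
    [∁A∪∁B]⊆∁[A∩B] (inj₂ ∉B) (_ , b) = ∉B b
    ∁[A∩B]⊆∁A∪∁B : ∁ (A ∩ B) ⊆ ∁ A ∪ ∁ B
    ∁[A∩B]⊆∁A∪∁B {x} ∉A∩B with em {x ∈ A}
    ... | yes a = inj₂ λ b → ∉A∩B (a , b)
    ... | no ∉A = inj₁ ∉A

  ∩-clopen : ∀ {A B} → Clopen τ A → Clopen τ B → Clopen τ (A ∩ B)
  ∩-clopen (A-open , A-closed) (B-open , B-closed) =
    open-∩ A-open B-open , ∩-closed A-closed B-closed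

  finite-subcover : Compact τ → (N : X → Subset X) →
                    (∀ x → Open (N x)) → (∀ x → x ∈ N x) →
                    ∃ λ n → Σ (Fin n → X) λ p → ∀ x → ∃ λ k → x ∈ N (p k)
  finite-subcover compact N N-open x∈N = compact X N N-open λ x → x , x∈N x

module PriestleyFacts (em : ExcludedMiddle 0ℓ) {X : Set} {τ : Topology X} {_≤_ : Rel X 0ℓ}
                      (P : IsPriestley τ _≤_) where
  open Topology τ
  open IsPriestley P
  open TopologyFacts em τ
  open OrderFacts em isPartialOrder

  ↑-closed : ∀ y → Closed τ (y ≤_)
  ↑-closed y =
    open-resp ⋃⊆∁↑y ∁↑y⊆⋃
      (open-⋃ (∃ λ w → ¬ y ≤ w) (∁ ∘ V) (proj₂ ∘ proj₁ ∘ V-props))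
    where
    V : (∃ λ w → ¬ y ≤ w) → Subset X
    V (w , y≰w) = proj₁ (separation y w y≰w)
    V-props : ∀ i → Clopen τ (V i) × UpSet _≤_ (V i) × y ∈ V i × proj₁ i ∉ V i
    V-props (w , y≰w) = proj₂ (separation y w y≰w)
    ⋃⊆∁↑y : (λ z → ∃ λ i → z ∉ V i) ⊆ ∁ (y ≤_)
    ⋃⊆∁↑y (i , z∉V) y≤z = let (_ , V-up , y∈V , _) = V-props i in z∉V (V-up y∈V y≤z)
    ∁↑y⊆⋃ : ∁ (y ≤_) ⊆ (λ z → ∃ λ i → z ∉ V i)
    ∁↑y⊆⋃ {z} y≰z = (z , y≰z) , proj₂ (proj₂ (proj₂ (V-props (z , y≰z))))

  -- Were C unbounded in K, the sets ∁K and ∁V (V a clopen upset through some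
  -- c ∈ C missing a point of K) would cover X, and the largest of the finitely
  -- many c involved would lie in no member of a finite subcover.
  closed-chain-bounded : ∀ {K} → Closed τ K → (∃ λ k → k ∈ K) →
                         ∀ C → C ⊆ K → IsChain _≤_ C →
                         ∃ λ u → u ∈ K × (∀ {c} → c ∈ C → c ≤ u)
  closed-chain-bounded {K} K-closed (k , k∈K) C C⊆K ch with em {∃ λ c → c ∈ C}
  ... | no ∄c = k , k∈K , λ c∈C → ⊥-elim (∄c (_ , c∈C))
  ... | yes (c₀ , c₀∈C) = em⇒dne em unbounded-absurd
    where
    record Patch (w : X) : Set₁ where
      field
        nbhd      : Subset X
        nbhd-open : Open nbhd
        centre    : w ∈ nbhd
        base      : X
        base∈C    : base ∈ C
        misses-↑  : ∀ {z} → z ∈ K → base ≤ z → z ∉ nbhd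

    module _ (unbounded : ¬ ∃ λ u → u ∈ K × (∀ {c} → c ∈ C → c ≤ u)) where
      not-below : ∀ {w} → w ∈ K → ∃ λ c → c ∈ C × ¬ c ≤ w
      not-below {w} w∈K = em⇒dne em λ ∄c →
        unbounded (w , w∈K , λ c∈C → em⇒dne em λ c≰w → ∄c (_ , c∈C , c≰w))

      patch : ∀ w → Patch w
      patch w with em {w ∈ K}
      ... | no w∉K =
        record { nbhd = ∁ K ; nbhd-open = K-closed ; centre = w∉K
               ; base = c₀ ; base∈C = c₀∈C
               ; misses-↑ = λ z∈K _ z∉K → z∉K z∈K }
      ... | yes w∈K with not-below w∈K
      ...   | c , c∈C , c≰w with separation c w c≰w
      ...     | V , (_ , V-closed) , V-up , c∈V , w∉V =
        record { nbhd = ∁ V ; nbhd-open = V-closed ; centre = w∉V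
               ; base = c ; base∈C = c∈C
               ; misses-↑ = λ _ c≤z z∉V → z∉V (V-up c∈V c≤z) }

      open Patch

      unbounded-absurd : ⊥
      unbounded-absurd
        with finite-subcover compact (nbhd ∘ patch) (nbhd-open ∘ patch) (centre ∘ patch)
      ... | n , p , covers with chain-finite-bound ch n (c₀ ∷ (base ∘ patch ∘ p))
                                  (λ { zero → c₀∈C ; (suc k) → base∈C (patch (p k)) })
      ...   | q , q∈C , ≤q with covers q
      ...     | k , q∈N = misses-↑ (patch (p k)) (C⊆K q∈C) (≤q (suc k)) q∈N

  closed-has-maximal : Zorn 0ℓ → ∀ {K} → Closed τ K → (∃ λ k → k ∈ K) →
                       ∃ (Max _≤_ K)
  closed-has-maximal zorn {K} K-closed K-nonempty =
    maximal-in zorn K (closed-chain-bounded K-closed K-nonempty)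

module _ {X : Set} (τ : Topology X) (_≤_ : Rel X 0ℓ) (X₀ : Subset X) where

  AdmissibleSeparation : Set₁
  AdmissibleSeparation = ∀ x y → ¬ x ≤ y →
                         ∃ λ (U : Subset X) → Admissible τ _≤_ X₀ U × x ∈ U × y ∉ U

  X₀-Separation : Set
  X₀-Separation = ∀ x y → ¬ x ≤ y → ∃ λ z → z ∈ X₀ × ¬ x ≤ z × y ≤ z

module Duality (em : ∀ ℓ → ExcludedMiddle ℓ) {X : Set} {τ : Topology X} {_≤_ : Rel X 0ℓ}
               {X₀ : Subset X} (P : IsPriestley τ _≤_)
               (cofinal : ∀ x → ∃ λ y → y ∈ X₀ × x ≤ y) where
  open Topology τ
  open IsPriestley P
  open TopologyFacts (em 0ℓ) τ
  open PriestleyFacts (em 0ℓ) P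
  private
    module PO = IsPartialOrder isPartialOrder
    dne : ∀ {ℓ} {A : Set ℓ} → ¬ ¬ A → A
    dne = em⇒dne (em _)

  Adm : Subset X → Set
  Adm = Admissible τ _≤_ X₀

  Good : Subset X → Set
  Good = GoodDown τ _≤_ X₀

  𝓘 : X → Subset X → Set
  𝓘 = InI τ _≤_ X₀

  admissible⇒∁-good : ∀ {U} → Adm U → Good (∁ U)
  admissible⇒∁-good (U-clopen , U-up , max∁U⊆X₀) =
    ∁-clopen U-clopen , (λ x∉U y≤x y∈U → x∉U (U-up y∈U y≤x)) , max∁U⊆X₀

  good⇒∁-admissible : ∀ {D} → Good D → Adm (∁ D)
  good⇒∁-admissible (D-clopen , D-down , maxD⊆X₀) =
    ∁-clopen D-clopen , (λ x∉D x≤y y∈D → x∉D (D-down y∈D x≤y)) ,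
    λ { (x∉∉D , x-max) →
          maxD⊆X₀ (dne x∉∉D , λ y y∈D x≤y → x-max y (λ y∉D → y∉D y∈D) x≤y) }

  ∅∈𝓘 : ∀ {x} → 𝓘 x ∅
  ∅∈𝓘 = (∅-clopen , (λ ()) , maxX⊆X₀) , λ ()
    where
    maxX⊆X₀ : Max _≤_ (∁ ∅) ⊆ X₀
    maxX⊆X₀ {x} (_ , x-max) with cofinal x
    ... | y , y∈X₀ , x≤y = subst (_∈ X₀) (sym (x-max y (λ ()) x≤y)) y∈X₀

  directed-finite-bound : ∀ {x} → IDirected τ _≤_ X₀ x → ∀ n (G : Fin n → Subset X) →
                          (∀ k → 𝓘 x (G k)) → ∃ λ W → 𝓘 x W × (∀ k → G k ⊆ W)
  directed-finite-bound {x} directed zero G _ = ∅ , ∅∈𝓘 {x} , λ ()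
  directed-finite-bound directed (suc n) G G∈𝓘
    with directed-finite-bound directed n (G ∘ suc) (G∈𝓘 ∘ suc)
  ... | W′ , W′∈𝓘 , G⊆W′ with directed (G zero) W′ (G∈𝓘 zero) W′∈𝓘
  ...   | W , W∈𝓘 , G₀⊆W , W′⊆W =
    W , W∈𝓘 , λ { zero → G₀⊆W ; (suc k) → W′⊆W ∘ G⊆W′ k }

  goodBasis⇒directed : ∀ x → GoodBasis τ _≤_ X₀ x → IDirected τ _≤_ X₀ x
  goodBasis⇒directed x basis U V ((U-clopen , U-up , _) , x∉U) ((V-clopen , V-up , _) , x∉V)
    with basis (∁ U ∩ ∁ V) (∩-clopen (∁-clopen U-clopen) (∁-clopen V-clopen))
               ∁U∩∁V-down (x∉U , x∉V)
    where
    ∁U∩∁V-down : DownSet _≤_ (∁ U ∩ ∁ V)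
    ∁U∩∁V-down (y∉U , y∉V) z≤y =
      (λ z∈U → y∉U (U-up z∈U z≤y)) , (λ z∈V → y∉V (V-up z∈V z≤y))
  ... | D , D-good , x∈D , D⊆∁U∩∁V =
    ∁ D , (good⇒∁-admissible D-good , λ x∉D → x∉D x∈D) ,
    (λ u y∈D → proj₁ (D⊆∁U∩∁V y∈D) u) , (λ v y∈D → proj₂ (D⊆∁U∩∁V y∈D) v)

  record CoverPatch (x : X) (D : Subset X) (y : X) : Set₁ where
    field
      nbhd      : Subset X
      nbhd-open : Open nbhd
      centre    : y ∈ nbhd
      ideal     : Subset X
      ideal∈𝓘   : 𝓘 x ideal
      covered   : nbhd ⊆ D ∪ ideal

  cover-patch : AdmissibleSeparation τ _≤_ X₀ →
                ∀ {x D} → Open D → DownSet _≤_ D → x ∈ D → ∀ y → CoverPatch x D y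
  cover-patch separate {x} {D} D-open D-down x∈D y with em 0ℓ {y ∈ D}
  ... | yes y∈D = record { nbhd = D ; nbhd-open = D-open ; centre = y∈D
                         ; ideal = ∅ ; ideal∈𝓘 = ∅∈𝓘 {x} ; covered = inj₁ }
  ... | no y∉D with separate y x (λ y≤x → y∉D (D-down x∈D y≤x))
  ...   | U , U-adm@((U-open , _) , _) , y∈U , x∉U =
    record { nbhd = U ; nbhd-open = U-open ; centre = y∈U
           ; ideal = U ; ideal∈𝓘 = U-adm , x∉U ; covered = inj₂ }

  module _ (separate : AdmissibleSeparation τ _≤_ X₀)
           {x} (directed : IDirected τ _≤_ X₀ x)
           {D} (D-open : Open D) (D-down : DownSet _≤_ D) (x∈D : x ∈ D) where
    open CoverPatch

    patch : ∀ y → CoverPatch x D y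
    patch = cover-patch separate D-open D-down x∈D

    𝓘-complement-within : ∃ λ W → 𝓘 x W × ∁ W ⊆ D
    𝓘-complement-within
      with finite-subcover compact (nbhd ∘ patch) (nbhd-open ∘ patch) (centre ∘ patch)
    ... | n , p , covers
      with directed-finite-bound directed n (ideal ∘ patch ∘ p) (ideal∈𝓘 ∘ patch ∘ p)
    ...   | W , W∈𝓘 , ideals⊆W = W , W∈𝓘 , ∁W⊆D
      where
      ∁W⊆D : ∁ W ⊆ D
      ∁W⊆D {z} z∉W with covers z
      ... | k , z∈N with covered (patch (p k)) z∈N
      ...   | inj₁ z∈D = z∈D
      ...   | inj₂ z∈G = ⊥-elim (z∉W (ideals⊆W k z∈G))

  directed⇒goodBasis : AdmissibleSeparation τ _≤_ X₀ →
                       ∀ x → IDirected τ _≤_ X₀ x → GoodBasis τ _≤_ X₀ x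
  directed⇒goodBasis separate x directed D (D-open , _) D-down x∈D
    with 𝓘-complement-within separate directed D-open D-down x∈D
  ... | W , (W-adm , x∉W) , ∁W⊆D = ∁ W , admissible⇒∁-good W-adm , x∉W , ∁W⊆D

  goodBasis⇔directed : AdmissibleSeparation τ _≤_ X₀ →
                       ∀ x → GoodBasis τ _≤_ X₀ x ⇔ IDirected τ _≤_ X₀ x
  goodBasis⇔directed separate x = mk⇔ (goodBasis⇒directed x) (directed⇒goodBasis separate x)

  X₀-separation⇒admissibleSeparation : (∀ z → z ∈ X₀ → GoodBasis τ _≤_ X₀ z) →
                                       X₀-Separation τ _≤_ X₀ →
                                       AdmissibleSeparation τ _≤_ X₀
  X₀-separation⇒admissibleSeparation basis separate x y x≰y with separate x y x≰y
  ... | z , z∈X₀ , x≰z , y≤z with separation x z x≰z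
  ...   | V , V-clopen , V-up , x∈V , z∉V
    with basis z z∈X₀ (∁ V) (∁-clopen V-clopen)
               (λ w∉V v≤w v∈V → w∉V (V-up v∈V v≤w)) z∉V
  ...     | D , D-good@(_ , D-down , _) , z∈D , D⊆∁V =
    ∁ D , good⇒∁-admissible D-good , (λ x∈D → D⊆∁V x∈D x∈V) ,
    (λ y∉D → y∉D (D-down z∈D y≤z))

  admissibleSeparation⇒X₀-separation : Zorn 0ℓ → AdmissibleSeparation τ _≤_ X₀ →
                                       X₀-Separation τ _≤_ X₀
  admissibleSeparation⇒X₀-separation zorn separate x y x≰y with separate x y x≰y
  ... | U , (U-clopen , U-up , max∁U⊆X₀) , x∈U , y∉U
    with closed-has-maximal zorn (∩-closed (↑-closed y) (proj₂ (∁-clopen U-clopen)))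
                                 (y , PO.refl , y∉U)
  ...   | m , (y≤m , m∉U) , m-max =
    m , max∁U⊆X₀ (m∉U , λ w w∉U m≤w → m-max w (PO.trans y≤m m≤w , w∉U) m≤w) ,
    (λ x≤m → m∉U (U-up x∈U x≤m)) , y≤m

  X*-Determines-≤ : Set₁
  X*-Determines-≤ = ∀ x y → (x ≤ y) ⇔ (∀ U → Adm U → x ∈ U → y ∈ U)

  admissibleSeparation⇔X*-determines-≤ : AdmissibleSeparation τ _≤_ X₀ ⇔ X*-Determines-≤
  admissibleSeparation⇔X*-determines-≤ = mk⇔ separation⇒determines determines⇒separation
    where
    separation⇒determines : AdmissibleSeparation τ _≤_ X₀ → X*-Determines-≤
    separation⇒determines separate x y =
      mk⇔ (λ x≤y U (_ , U-up , _) x∈U → U-up x∈U x≤y)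
          (λ upward → dne λ x≰y →
             let (U , U-adm , x∈U , y∉U) = separate x y x≰y in y∉U (upward U U-adm x∈U))
    determines⇒separation : X*-Determines-≤ → AdmissibleSeparation τ _≤_ X₀
    determines⇒separation determines x y x≰y = dne λ ∄U →
      x≰y (Equivalence.from (determines x y) λ U U-adm x∈U →
             dne λ y∉U → ∄U (U , U-adm , x∈U , y∉U))

proposition13p6 : (∀ (ℓ : Level) → ExcludedMiddle ℓ) → (∀ (ℓ : Level) → Zorn ℓ) →
    (X : Set) (τ : Topology X) (_≤_ : Rel X 0ℓ) (X₀ : Subset X) →
    IsHansoul τ _≤_ X₀ ⇔ IsGeneralizedPriestley τ _≤_ X₀
proposition13p6 em zorn X τ _≤_ X₀ = mk⇔ hansoul⇒generalized generalized⇒hansoul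
  where
  open Equivalence

  hansoul⇒generalized : IsHansoul τ _≤_ X₀ → IsGeneralizedPriestley τ _≤_ X₀
  hansoul⇒generalized H = record
    { priestley = priestley ; dense = dense ; cofinal = cofinal
    ; X₀-char   = λ x → goodBasis⇔directed separate′ x ⇔-∘ X₀-char x
    ; ≤-char    = to admissibleSeparation⇔X*-determines-≤ separate′ }
    where
    open IsHansoul H
    open Duality em priestley cofinal
    separate′ : AdmissibleSeparation τ _≤_ X₀
    separate′ = X₀-separation⇒admissibleSeparation (to ∘ X₀-char) separate

  generalized⇒hansoul : IsGeneralizedPriestley τ _≤_ X₀ → IsHansoul τ _≤_ X₀
  generalized⇒hansoul G = record
    { priestley = priestley ; dense = dense ; cofinal = cofinal
    ; separate  = admissibleSeparation⇒X₀-separation (zorn 0ℓ) separate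
    ; X₀-char   = λ x → ⇔-sym (goodBasis⇔directed separate x) ⇔-∘ X₀-char x }
    where
    open IsGeneralizedPriestley G
    open Duality em priestley cofinal
    separate : AdmissibleSeparation τ _≤_ X₀
    separate = from admissibleSeparation⇔X*-determines-≤ ≤-char
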